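{- Let $\ell\geq 1$ and $G\in S_{1,\ell}$. Then $G$ is a directed co-graph if and only if $G$ is $D_6$-free.
   Context: A set of sequences $Q$ consists of sequences of pairwise distinct items, each with a type. The sequence digraph $g(Q)$ has as vertex set the set of all types occurring in $Q$, and an arc $(u,v)$ iff $u\neq v$ and in some sequence an item of type $u$ occurs at a position strictly before an item of type $v$. $S_{k,\ell}$ is the class of all digraphs $g(Q)$ with $Q$ consisting of at most $k$ sequences and containing, summed over all sequences, at most $\ell$ items of each type. For vertex-disjoint digraphs $G_1=(V_1,E_1)$, $G_2=(V_2,E_2)$: the disjoint union $G_1\oplus G_2$ has vertex set $V_1\cup V_2$ and arc set $E_1\cup E_2$; the series composition $G_1\otimes G_2$ additionally has all arcs $(u,v),(v,u)$ for $u\in V_1,v\in V_2$; the order composition $G_1\oslash G_2$ additionally has all arcs $(u,v)$ for $u\in V_1,v\in V_2$. Directed co-graphs are the smallest class of digraphs containing the one-vertex digraph and closed under $\oplus$, $\otimes$, $\oslash$. A digraph is $D_6$-free if it has no induced subdigraph isomorphic to $D_6$, where $D_6$ is the digraph on $\{a,b,c,d\}$ with arc set $\{(a,b),(b,a),(a,c),(a,d),(b,c),(b,d),(c,b),(c,d),(d,c)\}$. -}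

module Defs where

open import Data.Nat using (ℕ; zero; suc; _+_; _≤_)
open import Data.Bool using (Bool; true; false)
open import Data.Fin as Fin using (Fin; splitAt)
open import Data.Fin.Properties using (_≟_)
open import Data.Sum using (_⊎_; inj₁; inj₂)
open import Data.Product using (Σ; ∃; ∃-syntax; _×_; _,_)
open import Data.List using (List; length; lookup; filter; map)
open import Data.Nat.ListAction using (sum)
open import Data.List.Relation.Unary.Any using (Any)
open import Data.List.Membership.Propositional using (_∈_)
open import Function.Bundles using (_⤖_; Bijection)
open import Function.Definitions using (Injective)
open import Relation.Binary.PropositionalEquality using (_≡_; _≢_)
open import Relation.Nullary using (¬_)

-- A (finite, loopless-by-convention) digraph on the vertex set Fin n,
-- given by its arc relation as a Boolean adjacency function.
record Digraph : Set where
  constructor digraph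
  field
    size : ℕ
    arc  : Fin size → Fin size → Bool
open Digraph public

_≅_ : Digraph → Digraph → Set
G ≅ H = Σ (Fin (size G) ⤖ Fin (size H)) λ f →
  ∀ u v → arc G u v ≡ arc H (Bijection.to f u) (Bijection.to f v)

oneVertex : Digraph
oneVertex = digraph 1 (λ _ _ → false)

_⊕_ : Digraph → Digraph → Digraph
G ⊕ H = digraph (size G + size H) a
  where
  a : Fin (size G + size H) → Fin (size G + size H) → Bool
  a u v with splitAt (size G) u | splitAt (size G) v
  ... | inj₁ x | inj₁ y = arc G x y
  ... | inj₂ x | inj₂ y = arc H x y
  ... | inj₁ _ | inj₂ _ = false
  ... | inj₂ _ | inj₁ _ = false

_⊗_ : Digraph → Digraph → Digraph
G ⊗ H = digraph (size G + size H) a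
  where
  a : Fin (size G + size H) → Fin (size G + size H) → Bool
  a u v with splitAt (size G) u | splitAt (size G) v
  ... | inj₁ x | inj₁ y = arc G x y
  ... | inj₂ x | inj₂ y = arc H x y
  ... | inj₁ _ | inj₂ _ = true
  ... | inj₂ _ | inj₁ _ = true

_⊘_ : Digraph → Digraph → Digraph
G ⊘ H = digraph (size G + size H) a
  where
  a : Fin (size G + size H) → Fin (size G + size H) → Bool
  a u v with splitAt (size G) u | splitAt (size G) v
  ... | inj₁ x | inj₁ y = arc G x y
  ... | inj₂ x | inj₂ y = arc H x y
  ... | inj₁ _ | inj₂ _ = true
  ... | inj₂ _ | inj₁ _ = false

-- Directed co-graphs: the smallest class containing the one-vertex digraph,
-- closed under ⊕, ⊗, ⊘ (and, since digraphs are considered up to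
-- isomorphism / relabelling of vertex-disjoint copies, under isomorphism).
data Cograph : Digraph → Set where
  single : Cograph oneVertex
  union  : ∀ {G H} → Cograph G → Cograph H → Cograph (G ⊕ H)
  series : ∀ {G H} → Cograph G → Cograph H → Cograph (G ⊗ H)
  order  : ∀ {G H} → Cograph G → Cograph H → Cograph (G ⊘ H)
  iso    : ∀ {G H} → Cograph G → G ≅ H → Cograph H

-- D₆ on {a,b,c,d} = {0,1,2,3}, arcs
-- (a,b),(b,a),(a,c),(a,d),(b,c),(b,d),(c,b),(c,d),(d,c).
D6arc : Fin 4 → Fin 4 → Bool
D6arc Fin.zero (Fin.suc Fin.zero) = true
D6arc (Fin.suc Fin.zero) Fin.zero = true
D6arc Fin.zero (Fin.suc (Fin.suc Fin.zero)) = true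
D6arc Fin.zero (Fin.suc (Fin.suc (Fin.suc Fin.zero))) = true
D6arc (Fin.suc Fin.zero) (Fin.suc (Fin.suc Fin.zero)) = true
D6arc (Fin.suc Fin.zero) (Fin.suc (Fin.suc (Fin.suc Fin.zero))) = true
D6arc (Fin.suc (Fin.suc Fin.zero)) (Fin.suc Fin.zero) = true
D6arc (Fin.suc (Fin.suc Fin.zero)) (Fin.suc (Fin.suc (Fin.suc Fin.zero))) = true
D6arc (Fin.suc (Fin.suc (Fin.suc Fin.zero))) (Fin.suc (Fin.suc Fin.zero)) = true
D6arc _ _ = false

D6 : Digraph
D6 = digraph 4 D6arc

HasInducedD6 : Digraph → Set
HasInducedD6 G = Σ (Fin 4 → Fin (size G)) λ f →
  Injective _≡_ _≡_ f × (∀ i j → i ≢ j → arc G (f i) (f j) ≡ D6arc i j)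

D6Free : Digraph → Set
D6Free G = ¬ HasInducedD6 G

-- A sequence is a list of items; item at position i has type (lookup s i).
-- Items are identified by their positions, hence pairwise distinct.
-- Types are labelled directly by the vertices of G (Fin (size G)).

OccursBefore : ∀ {n} → List (Fin n) → Fin n → Fin n → Set
OccursBefore s u v =
  ∃[ i ] ∃[ j ] (i Fin.< j × lookup s i ≡ u × lookup s j ≡ v)

occurrences : ∀ {n} → List (List (Fin n)) → Fin n → ℕ
occurrences Q u = sum (map (λ s → length (filter (_≟ u) s)) Q)

Represents : (G : Digraph) → List (List (Fin (size G))) → Set
Represents G Q =
  (∀ u → Any (u ∈_) Q) ×
  (∀ u v → arc G u v ≡ true → (u ≢ v × Any (λ s → OccursBefore s u v) Q)) ×
  (∀ u v → u ≢ v → Any (λ s → OccursBefore s u v) Q → arc G u v ≡ true)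

InS : ℕ → ℕ → Digraph → Set
InS k ℓ G = Σ (List (List (Fin (size G)))) λ Q →
  length Q ≤ k × (∀ u → occurrences Q u ≤ ℓ) × Represents G Q

module Submission where

-- Co-graph ⇒ D₆-free holds for every digraph.  Each composition ⊕, ⊗, ⊘ is a
-- "block composition" whose arcs between the two blocks follow one fixed
-- pattern (p, q); D₆ admits no non-trivial 2-colouring with a uniform (p, q)
-- pattern between the colours (split-constant), so an induced D₆ in a
-- composition lies inside one block, and induction on co-graphs applies.
--
-- A single sequence makes G an interval digraph: vertex
-- u spans from its first to its last occurrence, and u → v iff u ≠ v and u
-- starts before v ends.  In such a digraph, every vertex set with two members
-- either has a vertex overlapping all others (a series split), or can be cut
-- at a point no interval straddles (an order split), or contains an induced
-- D₆ built from a chain of furthest-reaching intervals.  Splitting repeatedly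
-- (module Splitting) realises G as a co-graph up to isomorphism.

open import Defs
open import Data.Bool using (Bool; true; false; not; _∨_)
import Data.Bool.Properties as BoolP
open import Data.Empty using (⊥; ⊥-elim)
open import Data.Fin as Fin using (Fin; splitAt; join; toℕ)
open import Data.Fin.Properties using (splitAt-join; join-splitAt)
import Data.Fin.Properties as FinP
open import Data.List using (List; []; _∷_; length; lookup; filter; allFin)
open import Data.List.Extrema.Nat using (argmax; argmin; argmax-all; argmin-all; f[xs]≤f[argmax]; f[argmin]≤f[xs])
open import Data.List.Membership.Propositional using (_∈_; find; lose)
open import Data.List.Membership.Propositional.Properties using (∈-filter⁺; ∈-filter⁻; ∈-allFin; ∈-lookup)
open import Data.List.Properties using (filter-notAll)
open import Data.List.Relation.Unary.All using (all?)
import Data.List.Relation.Unary.All as All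
open import Data.List.Relation.Unary.All.Properties using (¬All⇒Any¬)
open import Data.List.Relation.Unary.Any using (Any; here; there; any?)
open import Data.Nat using (ℕ; zero; suc; _+_; _≤_; _<_; z≤n; s≤s; _≤?_; _<?_)
open import Data.Nat.Properties using (<-irrefl; ≤-refl; ≤-trans; ≤-pred; <-≤-trans; ≤-<-trans; <⇒≢; <⇒≱; ≰⇒>; ≤∧≢⇒<; <-asym)
open import Data.Product using (Σ; ∃; _×_; _,_; proj₁; proj₂; map₂)
open import Data.Sum using (_⊎_; inj₁; inj₂; [_,_]′; fromInj₁; fromInj₂)
open import Data.Unit using (tt)
open import Function.Base using (_∘_; const; id)
open import Function.Bundles using (Bijection; mk⤖)
open import Function.Definitions using (Injective)
open import Relation.Binary.Definitions using (DecidableEquality)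
open import Relation.Binary.PropositionalEquality
open import Relation.Nullary using (¬_; Dec; yes; no)
open import Relation.Nullary.Decidable using (decidable-stable; toWitness; _⊎-dec_; _×-dec_; does; dec-true; dec-false)

pattern 𝟎 = Fin.zero
pattern 𝟏 = Fin.suc Fin.zero
pattern 𝟐 = Fin.suc (Fin.suc Fin.zero)
pattern 𝟑 = Fin.suc (Fin.suc (Fin.suc Fin.zero))

IsD6Embedding : {V : Set} → (V → V → Bool) → (Fin 4 → V) → Set
IsD6Embedding a g = Injective _≡_ _≡_ g × (∀ i j → i ≢ j → a (g i) (g j) ≡ D6arc i j)

EmbedsD6 : (V : Set) → (V → V → Bool) → Set
EmbedsD6 V a = Σ (Fin 4 → V) (IsD6Embedding a)

pull-D6 : ∀ {V W : Set} {a : V → V → Bool} {b : W → W → Bool} (k : V → W) →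
  (∀ u v → b (k u) (k v) ≡ a u v) →
  (g : Fin 4 → W) (h : Fin 4 → V) → (∀ i → k (h i) ≡ g i) →
  IsD6Embedding b g → IsD6Embedding a h
pull-D6 {a = a} {b} k reflects g h factors (g-inj , g-arc) = h-inj , h-arc
  where
  h-inj : Injective _≡_ _≡_ h
  h-inj {i} {j} eq = g-inj (trans (sym (factors i)) (trans (cong k eq) (factors j)))
  h-arc : ∀ i j → i ≢ j → a (h i) (h j) ≡ D6arc i j
  h-arc i j i≢j = begin
    a (h i) (h j)         ≡⟨ reflects (h i) (h j) ⟨
    b (k (h i)) (k (h j)) ≡⟨ cong₂ b (factors i) (factors j) ⟩
    b (g i) (g j)         ≡⟨ g-arc i j i≢j ⟩
    D6arc i j             ∎
    where open ≡-Reasoning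

blockArc : {A B : Set} → Bool → Bool → (A → A → Bool) → (B → B → Bool) →
  A ⊎ B → A ⊎ B → Bool
blockArc p q a b (inj₁ x) (inj₁ y) = a x y
blockArc p q a b (inj₂ x) (inj₂ y) = b x y
blockArc p q a b (inj₁ _) (inj₂ _) = p
blockArc p q a b (inj₂ _) (inj₁ _) = q

⊕-blocks : ∀ G H u v → arc (G ⊕ H) u v ≡
  blockArc false false (arc G) (arc H) (splitAt (size G) u) (splitAt (size G) v)
⊕-blocks G H u v with splitAt (size G) u | splitAt (size G) v
... | inj₁ _ | inj₁ _ = refl
... | inj₂ _ | inj₂ _ = refl
... | inj₁ _ | inj₂ _ = refl
... | inj₂ _ | inj₁ _ = refl

⊗-blocks : ∀ G H u v → arc (G ⊗ H) u v ≡
  blockArc true true (arc G) (arc H) (splitAt (size G) u) (splitAt (size G) v)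
⊗-blocks G H u v with splitAt (size G) u | splitAt (size G) v
... | inj₁ _ | inj₁ _ = refl
... | inj₂ _ | inj₂ _ = refl
... | inj₁ _ | inj₂ _ = refl
... | inj₂ _ | inj₁ _ = refl

⊘-blocks : ∀ G H u v → arc (G ⊘ H) u v ≡
  blockArc true false (arc G) (arc H) (splitAt (size G) u) (splitAt (size G) v)
⊘-blocks G H u v with splitAt (size G) u | splitAt (size G) v
... | inj₁ _ | inj₁ _ = refl
... | inj₂ _ | inj₂ _ = refl
... | inj₁ _ | inj₂ _ = refl
... | inj₂ _ | inj₁ _ = refl

blocks-D6 : ∀ {m n p q} {a : Fin m → Fin m → Bool} {b : Fin n → Fin n → Bool}
  (c : Fin (m + n) → Fin (m + n) → Bool) →
  (∀ u v → c u v ≡ blockArc p q a b (splitAt m u) (splitAt m v)) →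
  EmbedsD6 (Fin (m + n)) c → EmbedsD6 (Fin m ⊎ Fin n) (blockArc p q a b)
blocks-D6 {m} {n} {p} {q} {a} {b} c blocks (g , g-emb) =
  splitAt m ∘ g , pull-D6 {b = c} (join m n) reflects g (splitAt m ∘ g) (join-splitAt m n ∘ g) g-emb
  where
  reflects : ∀ x y → c (join m n x) (join m n y) ≡ blockArc p q a b x y
  reflects x y = trans (blocks _ _) (cong₂ (blockArc p q a b) (splitAt-join m n x) (splitAt-join m n y))

isLeft : {A B : Set} → A ⊎ B → Bool
isLeft (inj₁ _) = true
isLeft (inj₂ _) = false

Splits : Bool → Bool → (Fin 4 → Bool) → Set
Splits p q side = ∀ i j → side i ≡ true → side j ≡ false → D6arc i j ≡ p × D6arc j i ≡ q

same-colour : ∀ {p q side} → Splits p q side → ∀ i j →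
  ¬ (D6arc i j ≡ p × D6arc j i ≡ q) → ¬ (D6arc j i ≡ p × D6arc i j ≡ q) → side i ≡ side j
same-colour {side = side} splits i j no-ij no-ji with side i in si | side j in sj
... | true  | true  = refl
... | false | false = refl
... | true  | false = ⊥-elim (no-ij (splits i j si sj))
... | false | true  = ⊥-elim (no-ji (splits j i sj si))

path-constant : (side : Fin 4 → Bool) → side 𝟎 ≡ side 𝟏 → side 𝟏 ≡ side 𝟐 → side 𝟐 ≡ side 𝟑 →
  ∀ i → side i ≡ side 𝟎
path-constant side s01 s12 s23 𝟎 = refl
path-constant side s01 s12 s23 𝟏 = sym s01
path-constant side s01 s12 s23 𝟐 = sym (trans s01 s12)
path-constant side s01 s12 s23 𝟑 = sym (trans s01 (trans s12 s23))

-- D₆ has no non-trivial split of any kind: for (p, q) = (true, true) the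
-- one-way pairs c-a, a-d, d-b connect all of D₆, otherwise the two-way
-- pairs along the path a-b-c-d do.
split-constant : ∀ p q side → Splits p q side → ∀ i → side i ≡ side 𝟎
split-constant true true side splits = one-way-connected
  (same-colour splits 𝟎 𝟐 (λ { (_ , ()) }) (λ { (() , _) }))
  (same-colour splits 𝟎 𝟑 (λ { (_ , ()) }) (λ { (() , _) }))
  (same-colour splits 𝟏 𝟑 (λ { (_ , ()) }) (λ { (() , _) }))
  where
  one-way-connected : side 𝟎 ≡ side 𝟐 → side 𝟎 ≡ side 𝟑 → side 𝟏 ≡ side 𝟑 →
    ∀ i → side i ≡ side 𝟎
  one-way-connected s02 s03 s13 𝟎 = refl
  one-way-connected s02 s03 s13 𝟏 = trans s13 (sym s03)
  one-way-connected s02 s03 s13 𝟐 = sym s02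
  one-way-connected s02 s03 s13 𝟑 = sym s03
split-constant true false side splits = path-constant side
  (same-colour splits 𝟎 𝟏 (λ { (_ , ()) }) (λ { (_ , ()) }))
  (same-colour splits 𝟏 𝟐 (λ { (_ , ()) }) (λ { (_ , ()) }))
  (same-colour splits 𝟐 𝟑 (λ { (_ , ()) }) (λ { (_ , ()) }))
split-constant false q side splits = path-constant side
  (same-colour splits 𝟎 𝟏 (λ { (() , _) }) (λ { (() , _) }))
  (same-colour splits 𝟏 𝟐 (λ { (() , _) }) (λ { (() , _) }))
  (same-colour splits 𝟐 𝟑 (λ { (() , _) }) (λ { (() , _) }))

left-view : ∀ {A B : Set} {x₀ : A} (s : A ⊎ B) → isLeft s ≡ true → inj₁ (fromInj₁ (const x₀) s) ≡ s
left-view (inj₁ x) _ = refl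

right-view : ∀ {A B : Set} {y₀ : B} (s : A ⊎ B) → isLeft s ≡ false → inj₂ (fromInj₂ (const y₀) s) ≡ s
right-view (inj₂ y) _ = refl

blockArc-across : ∀ {A B : Set} {p q a b} (s t : A ⊎ B) → isLeft s ≡ true → isLeft t ≡ false →
  blockArc p q a b s t ≡ p × blockArc p q a b t s ≡ q
blockArc-across (inj₁ _) (inj₂ _) _ _ = refl , refl

-- An induced D₆ in a block composition lies entirely inside one block:
-- colouring its vertices by their block gives a split, which is constant.
block-D6 : ∀ {A B : Set} {p q a b} → EmbedsD6 (A ⊎ B) (blockArc p q a b) → EmbedsD6 A a ⊎ EmbedsD6 B b
block-D6 {A} {B} {p} {q} {a} {b} (g , g-inj , g-arc) = restrict (g 𝟎) refl
  where
  side : Fin 4 → Bool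
  side = isLeft ∘ g

  splits : Splits p q side
  splits i j si sj = trans (sym (g-arc i j i≢j)) ij , trans (sym (g-arc j i (i≢j ∘ sym))) ji
    where
    i≢j : i ≢ j
    i≢j refl with trans (sym si) sj
    ... | ()
    ij : blockArc p q a b (g i) (g j) ≡ p
    ij = proj₁ (blockArc-across (g i) (g j) si sj)
    ji : blockArc p q a b (g j) (g i) ≡ q
    ji = proj₂ (blockArc-across (g i) (g j) si sj)

  same-side-as-𝟎 : ∀ i → side i ≡ side 𝟎
  same-side-as-𝟎 = split-constant p q side splits

  restrict : ∀ s → g 𝟎 ≡ s → EmbedsD6 A a ⊎ EmbedsD6 B b
  restrict (inj₁ x₀) g₀ = inj₁ (fromInj₁ (const x₀) ∘ g ,
    pull-D6 {b = blockArc p q a b} inj₁ (λ _ _ → refl) g _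
      (λ i → left-view (g i) (trans (same-side-as-𝟎 i) (cong isLeft g₀))) (g-inj , g-arc))
  restrict (inj₂ y₀) g₀ = inj₂ (fromInj₂ (const y₀) ∘ g ,
    pull-D6 {b = blockArc p q a b} inj₂ (λ _ _ → refl) g _
      (λ i → right-view (g i) (trans (same-side-as-𝟎 i) (cong isLeft g₀))) (g-inj , g-arc))

iso-D6 : ∀ {G H} → G ≅ H → HasInducedD6 H → HasInducedD6 G
iso-D6 {G} {H} (φ , φ-arc) (g , g-emb) =
  h , pull-D6 {b = arc H} (Bijection.to φ) (λ u v → sym (φ-arc u v)) g h
        (λ i → proj₂ (Bijection.strictlySurjective φ (g i))) g-emb
  where
  h : Fin 4 → Fin (size G)
  h i = proj₁ (Bijection.strictlySurjective φ (g i))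

-- Every directed co-graph is D₆-free.  (The one-vertex digraph has no
-- injection from four vertices.)
cograph⇒D6-free : ∀ {G} → Cograph G → D6Free G
cograph⇒D6-free single (g , g-inj , _) with g 𝟎 in g₀ | g 𝟏 in g₁
... | Fin.zero | Fin.zero with g-inj (trans g₀ (sym g₁))
...   | ()
cograph⇒D6-free (union {G} {H} cG cH) =
  [ cograph⇒D6-free cG , cograph⇒D6-free cH ]′ ∘ block-D6 ∘ blocks-D6 (arc (G ⊕ H)) (⊕-blocks G H)
cograph⇒D6-free (series {G} {H} cG cH) =
  [ cograph⇒D6-free cG , cograph⇒D6-free cH ]′ ∘ block-D6 ∘ blocks-D6 (arc (G ⊗ H)) (⊗-blocks G H)
cograph⇒D6-free (order {G} {H} cG cH) =
  [ cograph⇒D6-free cG , cograph⇒D6-free cH ]′ ∘ block-D6 ∘ blocks-D6 (arc (G ⊘ H)) (⊘-blocks G H)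
cograph⇒D6-free (iso {G} {H} cG φ) = cograph⇒D6-free cG ∘ iso-D6 {G} {H} φ

-- Series or order composition, selected by the arcs running back from the
-- second block to the first; defined through the arcs so that its size is
-- visibly size G + size H.
compose : Bool → Digraph → Digraph → Digraph
compose back G H = digraph (size G + size H) (arcs back)
  where
  arcs : Bool → Fin (size G + size H) → Fin (size G + size H) → Bool
  arcs true  = arc (G ⊗ H)
  arcs false = arc (G ⊘ H)

compose-blocks : ∀ back G H u v → arc (compose back G H) u v ≡
  blockArc true back (arc G) (arc H) (splitAt (size G) u) (splitAt (size G) v)
compose-blocks true  = ⊗-blocks
compose-blocks false = ⊘-blocks

compose-cograph : ∀ back {G H} → Cograph G → Cograph H → Cograph (compose back G H)
compose-cograph true  = series
compose-cograph false = order

copair-injective : ∀ {A B C : Set} {f : A → C} {g : B → C} →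
  Injective _≡_ _≡_ f → Injective _≡_ _≡_ g → (∀ x y → f x ≢ g y) → Injective _≡_ _≡_ [ f , g ]′
copair-injective f-inj g-inj disjoint {inj₁ x} {inj₁ y} e = cong inj₁ (f-inj e)
copair-injective f-inj g-inj disjoint {inj₂ x} {inj₂ y} e = cong inj₂ (g-inj e)
copair-injective f-inj g-inj disjoint {inj₁ x} {inj₂ y} e = ⊥-elim (disjoint x y e)
copair-injective f-inj g-inj disjoint {inj₂ x} {inj₁ y} e = ⊥-elim (disjoint y x (sym e))

splitAt-injective : ∀ m {n} → Injective _≡_ _≡_ (splitAt m {n})
splitAt-injective m {n} {u} {v} e =
  trans (sym (join-splitAt m n u)) (trans (cong (join m n) e) (join-splitAt m n v))

-- Decomposing a digraph G by repeated splitting.  Vertex sets are lists xs of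
-- vertices of G (repetitions are harmless, only membership matters).
module Splitting (G : Digraph) where

  V : Set
  V = Fin (size G)

  -- A co-graph D together with an arc-preserving injection of its vertices
  -- onto the members of xs, i.e. an isomorphism onto G restricted to xs.
  record Realisation (xs : List V) : Set where
    field
      D                : Digraph
      cograph          : Cograph D
      vertex           : Fin (size D) → V
      vertex-injective : Injective _≡_ _≡_ vertex
      vertex-arc       : ∀ u v → arc D u v ≡ arc G (vertex u) (vertex v)
      vertex-∈         : ∀ u → vertex u ∈ xs
      vertex-onto      : ∀ {v} → v ∈ xs → ∃ λ u → vertex u ≡ v

  -- A split of xs into two non-empty blocks (the members with inFirst true,
  -- and the rest) such that every arc from the first block to the second is
  -- present, and the arcs back are uniformly present (back = true: a series
  -- composition) or uniformly absent (back = false: an order composition).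
  record Split (xs : List V) : Set where
    field
      inFirst       : V → Bool
      back          : Bool
      first-member  : ∃ λ y → y ∈ xs × inFirst y ≡ true
      second-member : ∃ λ z → z ∈ xs × inFirst z ≡ false
      forward-arcs  : ∀ {y z} → y ∈ xs → z ∈ xs → inFirst y ≡ true → inFirst z ≡ false →
                      arc G y z ≡ true
      backward-arcs : ∀ {y z} → y ∈ xs → z ∈ xs → inFirst y ≡ true → inFirst z ≡ false →
                      arc G z y ≡ back

  block : (V → Bool) → Bool → List V → List V
  block inFirst side = filter (λ v → inFirst v Data.Bool.≟ side)

  single-realisation : ∀ {a xs} → a ∈ xs → (∀ {v} → v ∈ xs → v ≡ a) → arc G a a ≡ false →
    Realisation xs
  single-realisation {a} a∈ only-a no-loop = record
    { D = oneVertex ; cograph = single ; vertex = const a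
    ; vertex-injective = λ { {Fin.zero} {Fin.zero} _ → refl }
    ; vertex-arc = λ _ _ → sym no-loop
    ; vertex-∈ = λ _ → a∈
    ; vertex-onto = λ v∈ → Fin.zero , sym (only-a v∈) }

  split-realisation : ∀ {xs} (S : Split xs) → let open Split S in
    Realisation (block inFirst true xs) → Realisation (block inFirst false xs) → Realisation xs
  split-realisation {xs} S R₁ R₂ = record
    { D = compose back D₁ D₂
    ; cograph = compose-cograph back cograph₁ cograph₂
    ; vertex = vertex′ ∘ splitAt (size D₁)
    ; vertex-injective = splitAt-injective (size D₁) ∘
        copair-injective vertex-injective₁ vertex-injective₂ disjoint
    ; vertex-arc = λ u v → trans (compose-blocks back D₁ D₂ u v) (block-arcs (splitAt _ u) (splitAt _ v))
    ; vertex-∈ = λ u → in-xs (splitAt (size D₁) u)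
    ; vertex-onto = onto }
    where
    open Split S
    open Realisation R₁ renaming (D to D₁; cograph to cograph₁; vertex to vertex₁;
      vertex-injective to vertex-injective₁; vertex-arc to vertex-arc₁; vertex-∈ to vertex-∈₁;
      vertex-onto to vertex-onto₁)
    open Realisation R₂ renaming (D to D₂; cograph to cograph₂; vertex to vertex₂;
      vertex-injective to vertex-injective₂; vertex-arc to vertex-arc₂; vertex-∈ to vertex-∈₂;
      vertex-onto to vertex-onto₂)

    vertex′ : Fin (size D₁) ⊎ Fin (size D₂) → V
    vertex′ = [ vertex₁ , vertex₂ ]′

    in-block : ∀ side {v} → v ∈ block inFirst side xs → v ∈ xs × inFirst v ≡ side
    in-block side = ∈-filter⁻ (λ v → inFirst v Data.Bool.≟ side)

    first₁ : ∀ x → vertex₁ x ∈ xs × inFirst (vertex₁ x) ≡ true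
    first₁ x = in-block true (vertex-∈₁ x)

    second₂ : ∀ y → vertex₂ y ∈ xs × inFirst (vertex₂ y) ≡ false
    second₂ y = in-block false (vertex-∈₂ y)

    disjoint : ∀ x y → vertex₁ x ≢ vertex₂ y
    disjoint x y e with trans (sym (proj₂ (first₁ x))) (trans (cong inFirst e) (proj₂ (second₂ y)))
    ... | ()

    in-xs : ∀ s → vertex′ s ∈ xs
    in-xs (inj₁ x) = proj₁ (first₁ x)
    in-xs (inj₂ y) = proj₁ (second₂ y)

    block-arcs : ∀ s t → blockArc true back (arc D₁) (arc D₂) s t ≡ arc G (vertex′ s) (vertex′ t)
    block-arcs (inj₁ x) (inj₁ x′) = vertex-arc₁ x x′
    block-arcs (inj₂ y) (inj₂ y′) = vertex-arc₂ y y′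
    block-arcs (inj₁ x) (inj₂ y) =
      sym (forward-arcs (proj₁ (first₁ x)) (proj₁ (second₂ y)) (proj₂ (first₁ x)) (proj₂ (second₂ y)))
    block-arcs (inj₂ y) (inj₁ x) =
      sym (backward-arcs (proj₁ (first₁ x)) (proj₁ (second₂ y)) (proj₂ (first₁ x)) (proj₂ (second₂ y)))

    onto-side : ∀ {v} s → vertex′ s ≡ v → ∃ λ u → vertex′ (splitAt (size D₁) u) ≡ v
    onto-side s e = join (size D₁) (size D₂) s ,
      trans (cong vertex′ (splitAt-join (size D₁) (size D₂) s)) e

    onto : ∀ {v} → v ∈ xs → ∃ λ u → vertex′ (splitAt (size D₁) u) ≡ v
    onto {v} v∈ with inFirst v in side
    ... | true  = let (x , e) = vertex-onto₁ (∈-filter⁺ (λ v → inFirst v Data.Bool.≟ true) v∈ side)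
                  in onto-side (inj₁ x) e
    ... | false = let (y , e) = vertex-onto₂ (∈-filter⁺ (λ v → inFirst v Data.Bool.≟ false) v∈ side)
                  in onto-side (inj₂ y) e

  realisation⇒cograph : Realisation (allFin (size G)) → Cograph G
  realisation⇒cograph R = iso cograph (mk⤖ (vertex-injective , onto) , vertex-arc)
    where
    open Realisation R
    onto : ∀ v → ∃ λ u → ∀ {u′} → u′ ≡ u → vertex u′ ≡ v
    onto v = let (u , e) = vertex-onto (∈-allFin v) in u , λ u′≡u → trans (cong vertex u′≡u) e

  module _ (loopless : ∀ v → arc G v v ≡ false)
           (split : ∀ {a a′ xs} → a ∈ xs → a′ ∈ xs → a ≢ a′ → Split xs) where

    realise : ∀ k xs {v} → length xs ≤ k → v ∈ xs → Realisation xs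
    realise zero    (a ∷ r) () _
    realise (suc k) (a ∷ r) (s≤s short) _ with all? (FinP._≟ a) r
    ... | yes all-a = single-realisation (here refl) only-a (loopless a)
      where
      only-a : ∀ {v} → v ∈ a ∷ r → v ≡ a
      only-a (here v≡a) = v≡a
      only-a (there v∈r) = All.lookup all-a v∈r
    ... | no not-all with find (¬All⇒Any¬ (FinP._≟ a) r not-all)
    ...   | a′ , a′∈r , a′≢a = realise-split (split (here refl) (there a′∈r) (a′≢a ∘ sym))
      where
      realise-split : Split (a ∷ r) → Realisation (a ∷ r)
      realise-split S = split-realisation S (realise-block true first-member second-member)
                                            (realise-block false second-member first-member)
        where
        open Split S
        -- each block is non-empty and misses a member of the other block,
        -- so it is shorter than a ∷ r
        realise-block : ∀ side → (∃ λ y → y ∈ a ∷ r × inFirst y ≡ side) →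
          (∃ λ z → z ∈ a ∷ r × inFirst z ≡ not side) → Realisation (block inFirst side (a ∷ r))
        realise-block side (y , y∈ , y-side) (z , z∈ , z-other) =
          realise k _ (≤-pred (≤-trans shorter (s≤s short))) (∈-filter⁺ in-side? y∈ y-side)
          where
          in-side? : (v : V) → Dec (inFirst v ≡ side)
          in-side? v = inFirst v Data.Bool.≟ side
          shorter : length (block inFirst side (a ∷ r)) < length (a ∷ r)
          shorter = filter-notAll in-side? (a ∷ r) (lose z∈ (λ z-side → BoolP.not-¬ z-side z-other))

    cograph-by-splitting : 0 < size G → Cograph G
    cograph-by-splitting nonempty =
      realisation⇒cograph (realise _ (allFin (size G)) ≤-refl (∈-allFin (Fin.fromℕ< nonempty)))

-- D₆ is semicomplete: any two distinct vertices are joined by an arc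
-- (checked by evaluation on all sixteen pairs).
D6-semicomplete : ∀ i j → i ≢ j → D6arc i j ∨ D6arc j i ≡ true
D6-semicomplete i j i≢j = [ ⊥-elim ∘ i≢j , id ]′ (all-pairs i j)
  where
  all-pairs : ∀ i j → i ≡ j ⊎ D6arc i j ∨ D6arc j i ≡ true
  all-pairs = toWitness {a? = FinP.all? λ i → FinP.all? λ j →
    (i FinP.≟ j) ⊎-dec (D6arc i j ∨ D6arc j i Data.Bool.≟ true)} tt

-- In a loopless digraph, a map reproducing the arcs of D₆ is injective:
-- two distinct vertices with the same image would need a loop there.
D6-map-injective : ∀ {V : Set} {a : V → V → Bool} → (∀ v → a v v ≡ false) → (g : Fin 4 → V) →
  (∀ i j → i ≢ j → a (g i) (g j) ≡ D6arc i j) → Injective _≡_ _≡_ g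
D6-map-injective {a = a} loopless g g-arc {i} {j} gi≡gj =
  decidable-stable (i FinP.≟ j) (λ i≢j → not-joined i≢j (D6-semicomplete i j i≢j))
  where
  no-arc : ∀ {k l} → k ≢ l → g k ≡ g l → D6arc k l ≡ false
  no-arc {k} {l} k≢l gk≡gl =
    trans (sym (g-arc k l k≢l)) (trans (cong (a (g k)) (sym gk≡gl)) (loopless (g k)))
  not-joined : i ≢ j → D6arc i j ∨ D6arc j i ≢ true
  not-joined i≢j joined with trans (sym joined) (cong₂ _∨_ (no-arc i≢j gi≡gj) (no-arc (i≢j ∘ sym) (sym gi≡gj)))
  ... | ()

maximiser : ∀ {A : Set} (f : A → ℕ) {x xs} → x ∈ xs → ∃ λ b → b ∈ xs × (∀ {v} → v ∈ xs → f v ≤ f b)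
maximiser f {x} {xs} x∈ =
  argmax f x xs , argmax-all f {P = _∈ xs} x∈ (All.tabulate id) , All.lookup (f[xs]≤f[argmax] x xs)

minimiser : ∀ {A : Set} (f : A → ℕ) {x xs} → x ∈ xs → ∃ λ b → b ∈ xs × (∀ {v} → v ∈ xs → f b ≤ f v)
minimiser f {x} {xs} x∈ =
  argmin f x xs , argmin-all f {P = _∈ xs} x∈ (All.tabulate id) , All.lookup (f[argmin]≤f[xs] x xs)

decided : ∀ {A : Set} (a? : Dec A) → does a? ≡ true → A
decided (yes a) _ = a

refuted : ∀ {A : Set} (a? : Dec A) → does a? ≡ false → ¬ A
refuted (no ¬a) _ = ¬a

record IntervalModel (G : Digraph) : Set where
  field
    first last      : Fin (size G) → ℕ
    first≤last      : ∀ u → first u ≤ last u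
    shared-endpoint : ∀ {u v} → first u ≡ last v → u ≡ v
    arc-sound       : ∀ {u v} → arc G u v ≡ true → u ≢ v × first u < last v
    arc-complete    : ∀ {u v} → u ≢ v → first u < last v → arc G u v ≡ true

module IntervalDigraph {G : Digraph} (M : IntervalModel G) where
  open IntervalModel M
  open Splitting G

  no-arc : ∀ {u v} → ¬ first u < last v → arc G u v ≡ false
  no-arc {u} {v} u≮v with arc G u v in uv
  ... | false = refl
  ... | true  = ⊥-elim (u≮v (proj₂ (arc-sound uv)))

  loopless : ∀ u → arc G u u ≡ false
  loopless u with arc G u u in uu
  ... | false = refl
  ... | true  = ⊥-elim (proj₁ (arc-sound uu) refl)

  -- distinct vertices never share an endpoint, so ≤ between endpoints is <
  strict : ∀ {u v} → u ≢ v → first u ≤ last v → first u < last v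
  strict u≢v u≤v = ≤∧≢⇒< u≤v (u≢v ∘ shared-endpoint)

  Before : V → V → Set
  Before u v = last u < first v

  Overlap : V → V → Set
  Overlap u v = u ≢ v × first u < last v × first v < last u

  before-arcs : ∀ {u v} → Before u v → arc G u v ≡ true × arc G v u ≡ false
  before-arcs {u} {v} u<v =
    arc-complete u≢v (≤-<-trans (first≤last u) (<-≤-trans u<v (first≤last v))) ,
    no-arc (λ v<u → <-asym v<u u<v)
    where
    u≢v : u ≢ v
    u≢v refl = <⇒≱ u<v (first≤last u)

  overlap-arcs : ∀ {u v} → Overlap u v → arc G u v ≡ true × arc G v u ≡ true
  overlap-arcs (u≢v , uv , vu) = arc-complete u≢v uv , arc-complete (u≢v ∘ sym) vu

  D6-pattern : ∀ {a b c d} → Overlap a b → Overlap b c → Overlap c d →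
    Before a c → Before a d → Before b d → HasInducedD6 G
  D6-pattern {a} {b} {c} {d} ab bc cd ac ad bd = g , D6-map-injective {a = arc G} loopless g g-arc , g-arc
    where
    g : Fin 4 → V
    g 𝟎 = a
    g 𝟏 = b
    g 𝟐 = c
    g 𝟑 = d
    g-arc : ∀ i j → i ≢ j → arc G (g i) (g j) ≡ D6arc i j
    g-arc 𝟎 𝟎 i≢j = ⊥-elim (i≢j refl)
    g-arc 𝟏 𝟏 i≢j = ⊥-elim (i≢j refl)
    g-arc 𝟐 𝟐 i≢j = ⊥-elim (i≢j refl)
    g-arc 𝟑 𝟑 i≢j = ⊥-elim (i≢j refl)
    g-arc 𝟎 𝟏 _ = proj₁ (overlap-arcs ab)
    g-arc 𝟏 𝟎 _ = proj₂ (overlap-arcs ab)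
    g-arc 𝟏 𝟐 _ = proj₁ (overlap-arcs bc)
    g-arc 𝟐 𝟏 _ = proj₂ (overlap-arcs bc)
    g-arc 𝟐 𝟑 _ = proj₁ (overlap-arcs cd)
    g-arc 𝟑 𝟐 _ = proj₂ (overlap-arcs cd)
    g-arc 𝟎 𝟐 _ = proj₁ (before-arcs ac)
    g-arc 𝟐 𝟎 _ = proj₂ (before-arcs ac)
    g-arc 𝟎 𝟑 _ = proj₁ (before-arcs ad)
    g-arc 𝟑 𝟎 _ = proj₂ (before-arcs ad)
    g-arc 𝟏 𝟑 _ = proj₁ (before-arcs bd)
    g-arc 𝟑 𝟏 _ = proj₂ (before-arcs bd)

  Straddles : ℕ → V → Set
  Straddles m v = first v ≤ m × m < last v

  -- Cutting at m: if some member ends by m, another starts after m and no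
  -- member straddles m, then the members ending by m lie before all the
  -- others, an order split.
  cut-split : ∀ {xs m y z} → y ∈ xs → last y ≤ m → z ∈ xs → m < first z →
    (∀ {v} → v ∈ xs → ¬ Straddles m v) → Split xs
  cut-split {xs} {m} {y} {z} y∈ y≤m z∈ m<z unstraddled = record
    { inFirst = ends-by ; back = false
    ; first-member = y , y∈ , dec-true (last y ≤? m) y≤m
    ; second-member = z , z∈ , dec-false (last z ≤? m) (λ z≤m → <⇒≱ m<z (≤-trans (first≤last z) z≤m))
    ; forward-arcs = λ _ z′∈ y′-in z′-out → proj₁ (before-arcs (ordered z′∈ y′-in z′-out))
    ; backward-arcs = λ _ z′∈ y′-in z′-out → proj₂ (before-arcs (ordered z′∈ y′-in z′-out)) }
    where
    ends-by : V → Bool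
    ends-by v = does (last v ≤? m)

    starts-after : ∀ {v} → v ∈ xs → ¬ last v ≤ m → m < first v
    starts-after {v} v∈ v≰m with first v ≤? m
    ... | yes v≤m = ⊥-elim (unstraddled v∈ (v≤m , ≰⇒> v≰m))
    ... | no v≰m′ = ≰⇒> v≰m′

    ordered : ∀ {y′ z′} → z′ ∈ xs → ends-by y′ ≡ true → ends-by z′ ≡ false → Before y′ z′
    ordered {y′} {z′} z′∈ y′-in z′-out =
      ≤-<-trans (decided (last y′ ≤? m) y′-in) (starts-after z′∈ (refuted (last z′ ≤? m) z′-out))

  universal-split : ∀ {xs b o} → b ∈ xs → o ∈ xs → o ≢ b →
    (∀ {v} → v ∈ xs → v ≢ b → Overlap b v) → Split xs
  universal-split {xs} {b} {o} b∈ o∈ o≢b overlaps = record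
    { inFirst = is-b ; back = true
    ; first-member = b , b∈ , dec-true (b FinP.≟ b) refl
    ; second-member = o , o∈ , dec-false (o FinP.≟ b) o≢b
    ; forward-arcs = λ _ z∈ y-in z-out → proj₁ (overlap-arcs (overlapping z∈ y-in z-out))
    ; backward-arcs = λ _ z∈ y-in z-out → proj₂ (overlap-arcs (overlapping z∈ y-in z-out)) }
    where
    is-b : V → Bool
    is-b v = does (v FinP.≟ b)

    overlapping : ∀ {y z} → z ∈ xs → is-b y ≡ true → is-b z ≡ false → Overlap y z
    overlapping {y} {z} z∈ y-in z-out rewrite decided (y FinP.≟ b) y-in =
      overlaps z∈ (refuted (z FinP.≟ b) z-out)

  cut-or-straddled : ∀ {xs m y z} → y ∈ xs → last y ≤ m → z ∈ xs → m < first z →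
    Split xs ⊎ ∃ λ c → c ∈ xs × Straddles m c
  cut-or-straddled {xs} {m} y∈ y≤m z∈ m<z with any? (λ v → first v ≤? m ×-dec m <? last v) xs
  ... | yes straddled  = inj₂ (find straddled)
  ... | no unstraddled = inj₁ (cut-split y∈ y≤m z∈ m<z (λ v∈ straddles → unstraddled (lose v∈ straddles)))

  record Furthest (xs : List V) (m : ℕ) : Set where
    field
      reacher   : V
      member    : reacher ∈ xs
      starts-by : first reacher ≤ m
      furthest  : ∀ {v} → v ∈ xs → first v ≤ m → last v ≤ last reacher
  open Furthest using (reacher)

  starts-by? : (m : ℕ) (v : V) → Dec (first v ≤ m)
  starts-by? m v = first v ≤? m

  find-furthest : ∀ {xs m x₀} → x₀ ∈ xs → first x₀ ≤ m → Furthest xs m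
  find-furthest {xs} {m} x₀∈ x₀≤m with maximiser last (∈-filter⁺ (starts-by? m) x₀∈ x₀≤m)
  ... | b , b∈ , b-max = record
    { reacher = b
    ; member = proj₁ (∈-filter⁻ (starts-by? m) {xs = xs} b∈)
    ; starts-by = proj₂ (∈-filter⁻ (starts-by? m) {xs = xs} b∈)
    ; furthest = λ v∈ v≤m → b-max (∈-filter⁺ (starts-by? m) v∈ v≤m) }

  module _ (D6-free : D6Free G) where

    -- With w ending first, b₁ furthest-reaching from the end of w and b₂
    -- furthest-reaching from the end of b₁ but lying after w, any x ≠ b₂
    -- starting between the ends of b₁ and b₂ completes the D₆ (w, b₁, b₂, x).
    chain-D6 : ∀ {xs w x} → (∀ {v} → v ∈ xs → last w ≤ last v) →
      (B₁ : Furthest xs (last w)) (B₂ : Furthest xs (last (reacher B₁))) → Before w (reacher B₂) →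
      last (reacher B₁) < first x → first x ≤ last (reacher B₂) → x ≢ reacher B₂ → ⊥
    chain-D6 {xs} {w} {x} w-min B₁ B₂ w<b₂ b₁<x x≤b₂ x≢b₂ =
      D6-free (D6-pattern w-b₁ b₁-b₂ b₂-x w<b₂ (≤-<-trans (w-min b₁∈) b₁<x) b₁<x)
      where
      open Furthest B₁ renaming (reacher to b₁; member to b₁∈; starts-by to b₁≤w)
      open Furthest B₂ renaming (reacher to b₂; starts-by to b₂≤b₁)
      b₁<b₂ : last b₁ < last b₂
      b₁<b₂ = <-≤-trans b₁<x x≤b₂
      w-b₁ : Overlap w b₁
      w-b₁ = w≢b₁ , strict w≢b₁ (≤-trans (first≤last w) (w-min b₁∈)) , strict (w≢b₁ ∘ sym) b₁≤w
        where
        w≢b₁ : w ≢ b₁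
        w≢b₁ refl = <⇒≱ w<b₂ b₂≤b₁
      b₁-b₂ : Overlap b₁ b₂
      b₁-b₂ = (λ b₁≡b₂ → <⇒≢ b₁<b₂ (cong last b₁≡b₂)) , ≤-<-trans (first≤last b₁) b₁<b₂ ,
              strict (λ b₂≡b₁ → <⇒≢ b₁<b₂ (cong last (sym b₂≡b₁))) b₂≤b₁
      b₂-x : Overlap b₂ x
      b₂-x = (x≢b₂ ∘ sym) , ≤-<-trans b₂≤b₁ (<-≤-trans b₁<x (first≤last x)) , strict x≢b₂ x≤b₂

    -- Let b₂ be
    -- furthest-reaching from the end of b₁.  Then xs is cut after b₂: z, or a
    -- member straddling the end of b₂, would complete a D₆ chain.
    beyond-b₁ : ∀ {xs w z c} → (∀ {v} → v ∈ xs → last w ≤ last v) → (B₁ : Furthest xs (last w)) →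
      z ∈ xs → last (reacher B₁) < first z → c ∈ xs → Straddles (last (reacher B₁)) c → Split xs
    beyond-b₁ {xs} {w} {z} w-min B₁ z∈ b₁<z c∈ (c≤b₁ , b₁<c) = cut-after-b₂ (first z ≤? last b₂)
      where
      open Furthest B₁ renaming (reacher to b₁; furthest to furthest₁)
      B₂ : Furthest xs (last b₁)
      B₂ = find-furthest c∈ c≤b₁
      open Furthest B₂ renaming (reacher to b₂; member to b₂∈; starts-by to b₂≤b₁; furthest to furthest₂)

      b₁<b₂ : last b₁ < last b₂
      b₁<b₂ = <-≤-trans b₁<c (furthest₂ c∈ c≤b₁)

      w<b₂ : Before w b₂
      w<b₂ = ≰⇒> (λ b₂≤w → <⇒≱ b₁<b₂ (furthest₁ b₂∈ b₂≤w))

      starts-after-b₁ : ∀ {v} → v ∈ xs → last b₂ < last v → last b₁ < first v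
      starts-after-b₁ v∈ b₂<v = ≰⇒> (λ v≤b₁ → <⇒≱ b₂<v (furthest₂ v∈ v≤b₁))

      z≢b₂ : z ≢ b₂
      z≢b₂ refl = <⇒≱ b₁<z b₂≤b₁

      cut-after-b₂ : Dec (first z ≤ last b₂) → Split xs
      cut-after-b₂ (yes z≤b₂) = ⊥-elim (chain-D6 w-min B₁ B₂ w<b₂ b₁<z z≤b₂ z≢b₂)
      cut-after-b₂ (no z≰b₂) with cut-or-straddled b₂∈ ≤-refl z∈ (≰⇒> z≰b₂)
      ... | inj₁ cut = cut
      ... | inj₂ (d , d∈ , d≤b₂ , b₂<d) =
        ⊥-elim (chain-D6 w-min B₁ B₂ w<b₂ (starts-after-b₁ d∈ b₂<d) d≤b₂ (λ { refl → <-irrefl refl b₂<d }))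

    -- First stage: if b₁, furthest-reaching from the end of the earliest-ending
    -- w, reaches the latest start z, then it overlaps every member and xs
    -- splits in series around b₁; otherwise xs is cut after b₁ or the second
    -- stage applies.
    split-at-b₁ : ∀ {xs w z a a′} → (∀ {v} → v ∈ xs → last w ≤ last v) →
      z ∈ xs → (∀ {v} → v ∈ xs → first v ≤ first z) → Furthest xs (last w) →
      a ∈ xs → a′ ∈ xs → a ≢ a′ → Split xs
    split-at-b₁ {xs} {w} {z} {a} {a′} w-min z∈ z-max B₁ a∈ a′∈ a≢a′ = around-b₁ (first z ≤? last b₁)
      where
      open Furthest B₁ renaming (reacher to b₁; member to b₁∈; starts-by to b₁≤w)

      other : ∃ λ o → o ∈ xs × o ≢ b₁
      other with a FinP.≟ b₁
      ... | yes refl = a′ , a′∈ , a≢a′ ∘ sym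
      ... | no a≢b₁  = a , a∈ , a≢b₁

      around-b₁ : Dec (first z ≤ last b₁) → Split xs
      around-b₁ (yes z≤b₁) = universal-split b₁∈ (proj₁ (proj₂ other)) (proj₂ (proj₂ other)) overlaps
        where
        overlaps : ∀ {v} → v ∈ xs → v ≢ b₁ → Overlap b₁ v
        overlaps v∈ v≢b₁ = v≢b₁ ∘ sym , strict (v≢b₁ ∘ sym) (≤-trans b₁≤w (w-min v∈)) ,
                           strict v≢b₁ (≤-trans (z-max v∈) z≤b₁)
      around-b₁ (no z≰b₁) with cut-or-straddled b₁∈ ≤-refl z∈ (≰⇒> z≰b₁)
      ... | inj₁ cut = cut
      ... | inj₂ (c , c∈ , straddles) = beyond-b₁ w-min B₁ z∈ (≰⇒> z≰b₁) c∈ straddles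

    split : ∀ {a a′ xs} → a ∈ xs → a′ ∈ xs → a ≢ a′ → Split xs
    split a∈ a′∈ a≢a′ with minimiser last a∈ | maximiser first a∈
    ... | w , w∈ , w-min | z , z∈ , z-max =
      split-at-b₁ w-min z∈ z-max (find-furthest w∈ (first≤last w)) a∈ a′∈ a≢a′

    interval-cograph : 0 < size G → Cograph G
    interval-cograph = cograph-by-splitting loopless split

module Occurrences {A : Set} (_≟_ : DecidableEquality A) where

  firstIndex : A → List A → ℕ
  firstIndex u [] = 0
  firstIndex u (x ∷ xs) with x ≟ u
  ... | yes _ = 0
  ... | no _  = suc (firstIndex u xs)

  lastIndex : A → List A → ℕ
  lastIndex u [] = 0
  lastIndex u (x ∷ xs) with any? (u ≟_) xs
  ... | yes _ = suc (lastIndex u xs)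
  ... | no _  = 0

  firstIndex-occurs : ∀ {u} s → u ∈ s → ∃ λ i → toℕ i ≡ firstIndex u s × lookup s i ≡ u
  firstIndex-occurs {u} (x ∷ xs) u∈ with x ≟ u
  ... | yes x≡u = Fin.zero , refl , x≡u
  firstIndex-occurs (x ∷ xs) (here u≡x)  | no x≢u = ⊥-elim (x≢u (sym u≡x))
  firstIndex-occurs (x ∷ xs) (there u∈) | no x≢u =
    let (i , i-first , i-u) = firstIndex-occurs xs u∈ in Fin.suc i , cong suc i-first , i-u

  firstIndex-minimal : ∀ {u} s i → lookup s i ≡ u → firstIndex u s ≤ toℕ i
  firstIndex-minimal {u} (x ∷ xs) i i-u with x ≟ u
  ... | yes _ = z≤n
  firstIndex-minimal (x ∷ xs) Fin.zero    i-u | no x≢u = ⊥-elim (x≢u i-u)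
  firstIndex-minimal (x ∷ xs) (Fin.suc i) i-u | no x≢u = s≤s (firstIndex-minimal xs i i-u)

  lastIndex-occurs : ∀ {u} s → u ∈ s → ∃ λ i → toℕ i ≡ lastIndex u s × lookup s i ≡ u
  lastIndex-occurs {u} (x ∷ xs) u∈ with any? (u ≟_) xs
  ... | yes u∈xs =
    let (i , i-last , i-u) = lastIndex-occurs xs u∈xs in Fin.suc i , cong suc i-last , i-u
  lastIndex-occurs (x ∷ xs) (here u≡x)  | no u∉xs = Fin.zero , refl , sym u≡x
  lastIndex-occurs (x ∷ xs) (there u∈) | no u∉xs = ⊥-elim (u∉xs u∈)

  lastIndex-maximal : ∀ {u} s i → lookup s i ≡ u → toℕ i ≤ lastIndex u s
  lastIndex-maximal (x ∷ xs) Fin.zero i-u = z≤n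
  lastIndex-maximal {u} (x ∷ xs) (Fin.suc i) i-u with any? (u ≟_) xs
  ... | yes _    = s≤s (lastIndex-maximal xs i i-u)
  ... | no u∉xs = ⊥-elim (u∉xs (subst (_∈ xs) i-u (∈-lookup i)))

-- A single sequence s containing every vertex, whose sequence digraph is G,
-- is an interval model of G: each vertex spans from its first to its last
-- occurrence, and positions hold one item each.
sequence-model : ∀ {G} (s : List (Fin (size G))) → (∀ u → u ∈ s) →
  (∀ u v → arc G u v ≡ true → u ≢ v × OccursBefore s u v) →
  (∀ u v → u ≢ v → OccursBefore s u v → arc G u v ≡ true) → IntervalModel G
sequence-model {G} s covers sound complete = record
  { first = λ u → firstIndex u s
  ; last = λ u → lastIndex u s
  ; first≤last = λ u → let (i , i-first , i-u) = firstIndex-occurs s (covers u)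
                        in subst (_≤ lastIndex u s) i-first (lastIndex-maximal s i i-u)
  ; shared-endpoint = shared-endpoint
  ; arc-sound = arc-sound
  ; arc-complete = arc-complete }
  where
  open Occurrences FinP._≟_

  shared-endpoint : ∀ {u v} → firstIndex u s ≡ lastIndex v s → u ≡ v
  shared-endpoint {u} {v} same =
    let (i , i-first , i-u) = firstIndex-occurs s (covers u)
        (j , j-last , j-v) = lastIndex-occurs s (covers v)
    in trans (sym i-u) (trans (cong (lookup s) (FinP.toℕ-injective (trans i-first (trans same (sym j-last))))) j-v)

  arc-sound : ∀ {u v} → arc G u v ≡ true → u ≢ v × firstIndex u s < lastIndex v s
  arc-sound {u} {v} uv with sound u v uv
  ... | u≢v , (i , j , i<j , i-u , j-v) =
    u≢v , ≤-<-trans (firstIndex-minimal s i i-u) (<-≤-trans i<j (lastIndex-maximal s j j-v))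

  arc-complete : ∀ {u v} → u ≢ v → firstIndex u s < lastIndex v s → arc G u v ≡ true
  arc-complete {u} {v} u≢v u<v =
    let (i , i-first , i-u) = firstIndex-occurs s (covers u)
        (j , j-last , j-v) = lastIndex-occurs s (covers v)
    in complete u v u≢v (i , j , subst₂ _<_ (sym i-first) (sym j-last) u<v , i-u , j-v)

single-sequence-model : ∀ {G} (Q : List (List (Fin (size G)))) → length Q ≤ 1 → 0 < size G →
  Represents G Q → IntervalModel G
single-sequence-model {G} [] _ nonempty (covers , _) with covers (Fin.fromℕ< nonempty)
... | ()
single-sequence-model (s ∷ _ ∷ _) (s≤s ()) _ _
single-sequence-model {G} (s ∷ []) _ _ (covers , sound , complete) =
  sequence-model s (only ∘ covers) (λ u v uv → map₂ only (sound u v uv))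
    (λ u v u≢v u-before-v → complete u v u≢v (here u-before-v))
  where
  only : ∀ {P : List (Fin (size G)) → Set} → Any P (s ∷ []) → P s
  only (here p) = p

proposition4p38 : (ℓ : ℕ) → 1 ≤ ℓ → (G : Digraph) → 0 < size G → InS 1 ℓ G →
    (Cograph G → D6Free G) × (D6Free G → Cograph G)
proposition4p38 ℓ _ G nonempty (Q , one-sequence , _ , represents) =
  cograph⇒D6-free ,
  λ D6-free → IntervalDigraph.interval-cograph model D6-free nonempty
  where
  model : IntervalModel G
  model = single-sequence-model Q one-sequence nonempty represents
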